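{- Let $G$ be a non-diregular $k$-geodetic digraph that is out-regular of degree $d$ and has order $M(d,k)+\epsilon$. Let $S=\{v: d^-(v)<d\}$ and $S'=\{v: d^-(v)>d\}$. Then $|S|\leq \epsilon d$ and $|S'|\leq \epsilon d$.
   Context: $M(d,k)=1+d+\dots+d^k$. A digraph is $k$-geodetic if for any two vertices $u,v$ there is at most one directed walk from $u$ to $v$ of length at most $k$. -}

module Defs where

open import Data.Nat using (ℕ; zero; suc; _+_; _*_; _^_; _≤_; _<_; _>_)
open import Data.Fin using (Fin)
open import Data.Bool using (Bool; true; false; if_then_else_)
open import Data.Vec.Functional using (foldr)
open import Relation.Nullary using (¬_; does)
open import Relation.Binary.PropositionalEquality using (_≡_)
import Data.Fin as F
import Data.Nat as N

M : ℕ → ℕ → ℕ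
M d zero    = 1
M d (suc k) = M d k + d ^ suc k

∑ : ∀ {n} → (Fin n → ℕ) → ℕ
∑ {n} f = foldr _+_ 0 f

count : ∀ {n} → (Fin n → Bool) → ℕ
count P = ∑ (λ i → if P i then 1 else 0)

Digraph : ℕ → Set
Digraph n = Fin n → Fin n → Bool

module _ {n : ℕ} (G : Digraph n) where

  outdeg : Fin n → ℕ
  outdeg v = count (λ w → G v w)

  indeg : Fin n → ℕ
  indeg v = count (λ u → G u v)

  walks : ℕ → Fin n → Fin n → ℕ
  walks zero    u v = if does (u F.≟ v) then 1 else 0
  walks (suc ℓ) u v = ∑ (λ w → if G u w then walks ℓ w v else 0)

  walks≤ : ℕ → Fin n → Fin n → ℕ
  walks≤ zero    u v = walks zero u v
  walks≤ (suc k) u v = walks≤ k u v + walks (suc k) u v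

  Geodetic : ℕ → Set
  Geodetic k = ∀ u v → walks≤ k u v ≤ 1

  OutRegular : ℕ → Set
  OutRegular d = ∀ v → outdeg v ≡ d

  Diregular : ℕ → Set
  Diregular d = ∀ v → outdeg v ≡ d × indeg v ≡ d
    where open import Data.Product using (_×_)

  deficient : ℕ → ℕ
  deficient d = count (λ v → does (indeg v N.<? d))

  excess : ℕ → ℕ
  excess d = count (λ v → does (d N.<? indeg v))

module Submission where

-- Fix any vertex u.  Since G is k-geodetic, walks of length ≤ k from a vertex
-- reach every vertex at most once, and out-regularity makes exactly M(d,k) of
-- them reachable; so every vertex w has exactly ε vertices it does not reach
-- within k steps.  Counting the walks of length 1..k+1 from u to v once by
-- their last arc and once by their first arc gives the balance identity
--     d⁻(v) + B(v) = d + A(v),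
-- where A(v) = #{in-neighbours of v not reached from u within k steps} and
-- B(v) = #{out-neighbours w of u that do not reach v within k steps}.
-- Hence d⁻(v) > d forces A(v) ≥ 1 and d⁻(v) < d forces B(v) ≥ 1, while
-- double counting gives ∑ A = ε·d and ∑ B = d·ε.

open import Defs
open import Data.Nat using (ℕ; zero; suc; _+_; _*_; _^_; _∸_; _≤_; _<_; z≤n; _<?_)
open import Data.Nat.Properties
open import Data.Fin using (Fin)
import Data.Fin as F
open import Data.Bool using (true; false; if_then_else_)
open import Data.Product using (_×_; _,_)
open import Relation.Nullary using (¬_; yes; no; does)
open import Relation.Unary using (Pred; Decidable)
open import Relation.Binary.PropositionalEquality
open import Algebra.Properties.Semiring.Sum +-*-semiring
  using (sum-cong-≗; sum-replicate-zero; ∑-distrib-+; ∑-comm; *-distribˡ-sum; *-distribʳ-sum)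
open import Algebra.Properties.CommutativeSemigroup +-commutativeSemigroup
  using (xy∙z≈xz∙y)

-- Finite sums over Fin n.  Defs.∑ is definitionally the library's semiring
-- sum over ℕ, so the library lemmas on sums apply to it directly; the few
-- facts below are not in the library.

∑-mono : ∀ {n} {f g : Fin n → ℕ} → (∀ i → f i ≤ g i) → ∑ f ≤ ∑ g
∑-mono {zero}  f≤g = z≤n
∑-mono {suc n} f≤g = +-mono-≤ (f≤g F.zero) (∑-mono (λ i → f≤g (F.suc i)))

∑-ones : ∀ {n} → ∑ {n} (λ _ → 1) ≡ n
∑-ones {zero}  = refl
∑-ones {suc n} = cong suc (∑-ones {n})

count-≤-∑ : ∀ {n} {p} {P : Pred (Fin n) p} (P? : Decidable P) (f : Fin n → ℕ) →
            (∀ i → P i → 0 < f i) → count (λ i → does (P? i)) ≤ ∑ f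
count-≤-∑ P? f pos = ∑-mono indicator≤
  where
  indicator≤ : ∀ i → (if does (P? i) then 1 else 0) ≤ f i
  indicator≤ i with P? i
  ... | yes p = pos i p
  ... | no  _ = z≤n

δ : ∀ {n} → Fin n → Fin n → ℕ
δ u v = if does (u F.≟ v) then 1 else 0

δ-suc : ∀ {n} (u v : Fin n) → δ (F.suc u) (F.suc v) ≡ δ u v
δ-suc u v with u F.≟ v
... | yes _ = refl
... | no  _ = refl

δ-sym : ∀ {n} (u v : Fin n) → δ u v ≡ δ v u
δ-sym F.zero    F.zero    = refl
δ-sym F.zero    (F.suc v) = refl
δ-sym (F.suc u) F.zero    = refl
δ-sym (F.suc u) (F.suc v) = trans (δ-suc u v) (trans (δ-sym u v) (sym (δ-suc v u)))

∑-δˡ : ∀ {n} (u : Fin n) (f : Fin n → ℕ) → ∑ (λ w → δ u w * f w) ≡ f u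
∑-δˡ {suc n} F.zero    f =
  trans (cong₂ _+_ (+-identityʳ (f F.zero)) (sum-replicate-zero n)) (+-identityʳ (f F.zero))
∑-δˡ {suc n} (F.suc u) f =
  trans (sum-cong-≗ (λ w → cong (_* f (F.suc w)) (δ-suc u w))) (∑-δˡ u (λ w → f (F.suc w)))

∑-δʳ : ∀ {n} (v : Fin n) (f : Fin n → ℕ) → ∑ (λ w → f w * δ w v) ≡ f v
∑-δʳ v f = trans (sum-cong-≗ (λ w → trans (*-comm (f w) _) (cong (_* f w) (δ-sym w v))))
                 (∑-δˡ v f)

∑∑-assoc : ∀ {l m} (a : Fin l → ℕ) (b : Fin l → Fin m → ℕ) (c : Fin m → ℕ) →
           ∑ (λ w → a w * ∑ (λ x → b w x * c x)) ≡ ∑ (λ x → ∑ (λ w → a w * b w x) * c x)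
∑∑-assoc a b c = begin
  ∑ (λ w → a w * ∑ (λ x → b w x * c x))   ≡⟨ sum-cong-≗ (λ w → *-distribˡ-sum (a w) (λ x → b w x * c x)) ⟩
  ∑ (λ w → ∑ (λ x → a w * (b w x * c x))) ≡⟨ ∑-comm (λ w x → a w * (b w x * c x)) ⟩
  ∑ (λ x → ∑ (λ w → a w * (b w x * c x))) ≡⟨ sum-cong-≗ (λ x → sum-cong-≗ (λ w → sym (*-assoc (a w) (b w x) (c x)))) ⟩
  ∑ (λ x → ∑ (λ w → a w * b w x * c x))   ≡⟨ sum-cong-≗ (λ x → sym (*-distribʳ-sum (c x) (λ w → a w * b w x))) ⟩
  ∑ (λ x → ∑ (λ w → a w * b w x) * c x)   ∎
  where open ≡-Reasoning

∑-split : ∀ {n} (p q f : Fin n → ℕ) → (∀ w → p w + q w ≡ 1) →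
          ∑ f ≡ ∑ (λ w → p w * f w) + ∑ (λ w → q w * f w)
∑-split p q f p+q≡1 = begin
  ∑ f                                   ≡⟨ sum-cong-≗ unit ⟩
  ∑ (λ w → p w * f w + q w * f w)       ≡⟨ ∑-distrib-+ (λ w → p w * f w) (λ w → q w * f w) ⟩
  ∑ (λ w → p w * f w) + ∑ (λ w → q w * f w) ∎
  where
  open ≡-Reasoning
  unit : ∀ w → f w ≡ p w * f w + q w * f w
  unit w = begin
    f w                   ≡⟨ sym (*-identityˡ (f w)) ⟩
    1 * f w               ≡⟨ cong (_* f w) (sym (p+q≡1 w)) ⟩
    (p w + q w) * f w     ≡⟨ *-distribʳ-+ (f w) (p w) (q w) ⟩
    p w * f w + q w * f w ∎

∑-splitʳ : ∀ {n} (p q f : Fin n → ℕ) → (∀ w → p w + q w ≡ 1) →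
           ∑ f ≡ ∑ (λ w → f w * p w) + ∑ (λ w → f w * q w)
∑-splitʳ p q f p+q≡1 = trans (∑-split p q f p+q≡1)
  (cong₂ _+_ (sum-cong-≗ (λ w → *-comm (p w) (f w))) (sum-cong-≗ (λ w → *-comm (q w) (f w))))

if-as-product : ∀ b x → (if b then x else 0) ≡ (if b then 1 else 0) * x
if-as-product true  x = sym (+-identityʳ x)
if-as-product false x = refl

module WalkCounting {n : ℕ} (G : Digraph n) where

  arc : Fin n → Fin n → ℕ
  arc u w = if G u w then 1 else 0

  walks-first : ∀ ℓ u v → walks G (suc ℓ) u v ≡ ∑ (λ w → arc u w * walks G ℓ w v)
  walks-first ℓ u v = sum-cong-≗ (λ w → if-as-product (G u w) (walks G ℓ w v))

  walks-last : ∀ ℓ u v → walks G (suc ℓ) u v ≡ ∑ (λ w → walks G ℓ u w * arc w v)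
  walks-last zero u v = begin
    walks G 1 u v                  ≡⟨ walks-first 0 u v ⟩
    ∑ (λ w → arc u w * δ w v)      ≡⟨ ∑-δʳ v (arc u) ⟩
    arc u v                        ≡⟨ sym (∑-δˡ u (λ w → arc w v)) ⟩
    ∑ (λ w → δ u w * arc w v)      ∎
    where open ≡-Reasoning
  walks-last (suc ℓ) u v = begin
    walks G (suc (suc ℓ)) u v                                     ≡⟨ walks-first (suc ℓ) u v ⟩
    ∑ (λ w → arc u w * walks G (suc ℓ) w v)                       ≡⟨ sum-cong-≗ (λ w → cong (arc u w *_) (walks-last ℓ w v)) ⟩
    ∑ (λ w → arc u w * ∑ (λ x → walks G ℓ w x * arc x v))         ≡⟨ ∑∑-assoc (arc u) (walks G ℓ) (λ x → arc x v) ⟩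
    ∑ (λ x → ∑ (λ w → arc u w * walks G ℓ w x) * arc x v)         ≡⟨ sum-cong-≗ (λ x → cong (_* arc x v) (sym (walks-first ℓ u x))) ⟩
    ∑ (λ x → walks G (suc ℓ) u x * arc x v)                       ∎
    where open ≡-Reasoning

  -- The walks of length 1, …, k+1 from u to v, counted by their last arc and
  -- by their first arc.
  last-arc≡first-arc : ∀ k u v →
    ∑ (λ w → walks≤ G k u w * arc w v) ≡ ∑ (λ w → arc u w * walks≤ G k w v)
  last-arc≡first-arc zero    u v = trans (sym (walks-last 0 u v)) (walks-first 0 u v)
  last-arc≡first-arc (suc k) u v = begin
    ∑ (λ w → (walks≤ G k u w + walks G (suc k) u w) * arc w v)
      ≡⟨ sum-cong-≗ (λ w → *-distribʳ-+ (arc w v) (walks≤ G k u w) _) ⟩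
    ∑ (λ w → walks≤ G k u w * arc w v + walks G (suc k) u w * arc w v)
      ≡⟨ ∑-distrib-+ (λ w → walks≤ G k u w * arc w v) (λ w → walks G (suc k) u w * arc w v) ⟩
    ∑ (λ w → walks≤ G k u w * arc w v) + ∑ (λ w → walks G (suc k) u w * arc w v)
      ≡⟨ cong₂ _+_ (last-arc≡first-arc k u v)
                   (trans (sym (walks-last (suc k) u v)) (walks-first (suc k) u v)) ⟩
    ∑ (λ w → arc u w * walks≤ G k w v) + ∑ (λ w → arc u w * walks G (suc k) w v)
      ≡⟨ sym (∑-distrib-+ (λ w → arc u w * walks≤ G k w v) (λ w → arc u w * walks G (suc k) w v)) ⟩
    ∑ (λ w → arc u w * walks≤ G k w v + arc u w * walks G (suc k) w v)
      ≡⟨ sum-cong-≗ (λ w → sym (*-distribˡ-+ (arc u w) (walks≤ G k w v) _)) ⟩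
    ∑ (λ w → arc u w * (walks≤ G k w v + walks G (suc k) w v)) ∎
    where open ≡-Reasoning

  module OutRegularWalks (d : ℕ) (regular : OutRegular G d) where

    walks-from : ∀ t u → ∑ (walks G t u) ≡ d ^ t
    walks-from zero    u = trans (sum-cong-≗ (λ w → sym (*-identityʳ (δ u w)))) (∑-δˡ u (λ _ → 1))
    walks-from (suc t) u = begin
      ∑ (walks G (suc t) u)                    ≡⟨ sum-cong-≗ (walks-first t u) ⟩
      ∑ (λ v → ∑ (λ w → arc u w * walks G t w v)) ≡⟨ ∑-comm (λ v w → arc u w * walks G t w v) ⟩
      ∑ (λ w → ∑ (λ v → arc u w * walks G t w v)) ≡⟨ sum-cong-≗ (λ w → sym (*-distribˡ-sum (arc u w) (walks G t w))) ⟩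
      ∑ (λ w → arc u w * ∑ (walks G t w))      ≡⟨ sum-cong-≗ (λ w → cong (arc u w *_) (walks-from t w)) ⟩
      ∑ (λ w → arc u w * d ^ t)                ≡⟨ sym (*-distribʳ-sum (d ^ t) (arc u)) ⟩
      ∑ (arc u) * d ^ t                        ≡⟨ cong (_* d ^ t) (regular u) ⟩
      d * d ^ t                                ∎
      where open ≡-Reasoning

    walks≤-from : ∀ k u → ∑ (walks≤ G k u) ≡ M d k
    walks≤-from zero    u = walks-from zero u
    walks≤-from (suc k) u =
      trans (∑-distrib-+ (walks≤ G k u) (walks G (suc k) u))
            (cong₂ _+_ (walks≤-from k u) (walks-from (suc k) u))

module Excess (d k ε : ℕ) (G : Digraph (M d k + ε))
              (geodetic : Geodetic G k) (regular : OutRegular G d) where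

  open WalkCounting G
  open OutRegularWalks d regular

  unreached : Fin (M d k + ε) → Fin (M d k + ε) → ℕ
  unreached u w = 1 ∸ walks≤ G k u w

  reached+unreached : ∀ u w → walks≤ G k u w + unreached u w ≡ 1
  reached+unreached u w = m+[n∸m]≡n (geodetic u w)

  unreached-count : ∀ u → ∑ (unreached u) ≡ ε
  unreached-count u = +-cancelˡ-≡ (M d k) _ _ (begin
    M d k + ∑ (unreached u)             ≡⟨ cong (_+ ∑ (unreached u)) (sym (walks≤-from k u)) ⟩
    ∑ (walks≤ G k u) + ∑ (unreached u)  ≡⟨ sym (∑-distrib-+ (walks≤ G k u) (unreached u)) ⟩
    ∑ (λ w → walks≤ G k u w + unreached u w) ≡⟨ sum-cong-≗ (reached+unreached u) ⟩
    ∑ {M d k + ε} (λ _ → 1)             ≡⟨ ∑-ones ⟩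
    M d k + ε                           ∎)
    where open ≡-Reasoning

  module _ (u : Fin (M d k + ε)) where

    missedIn : Fin (M d k + ε) → ℕ
    missedIn v = ∑ (λ w → unreached u w * arc w v)

    missedOut : Fin (M d k + ε) → ℕ
    missedOut v = ∑ (λ w → arc u w * unreached w v)

    -- Split the in-arcs of v and the out-arcs of u by reachability; the
    -- reachable parts agree by last-arc≡first-arc.
    balance : ∀ v → indeg G v + missedOut v ≡ d + missedIn v
    balance v = begin
      indeg G v + missedOut v                          ≡⟨ cong (_+ missedOut v) indeg-split ⟩
      reachedIn + missedIn v + missedOut v             ≡⟨ xy∙z≈xz∙y reachedIn (missedIn v) (missedOut v) ⟩
      reachedIn + missedOut v + missedIn v             ≡⟨ cong (λ r → r + missedOut v + missedIn v) (last-arc≡first-arc k u v) ⟩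
      reachedOut + missedOut v + missedIn v            ≡⟨ cong (_+ missedIn v) (sym outdeg-split) ⟩
      d + missedIn v                                   ∎
      where
      open ≡-Reasoning
      reachedIn reachedOut : ℕ
      reachedIn  = ∑ (λ w → walks≤ G k u w * arc w v)
      reachedOut = ∑ (λ w → arc u w * walks≤ G k w v)
      indeg-split : indeg G v ≡ reachedIn + missedIn v
      indeg-split = ∑-split (walks≤ G k u) (unreached u) (λ w → arc w v) (reached+unreached u)
      outdeg-split : d ≡ reachedOut + missedOut v
      outdeg-split = trans (sym (regular u))
        (∑-splitʳ (λ w → walks≤ G k w v) (λ w → unreached w v) (arc u) (λ w → reached+unreached w v))

    -- Double counting: each vertex w unreached from u contributes its d out-arcs.
    ∑-missedIn : ∑ missedIn ≡ ε * d
    ∑-missedIn = begin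
      ∑ (λ v → ∑ (λ w → unreached u w * arc w v)) ≡⟨ ∑-comm (λ v w → unreached u w * arc w v) ⟩
      ∑ (λ w → ∑ (λ v → unreached u w * arc w v)) ≡⟨ sum-cong-≗ (λ w → sym (*-distribˡ-sum (unreached u w) (arc w))) ⟩
      ∑ (λ w → unreached u w * ∑ (arc w))         ≡⟨ sum-cong-≗ (λ w → cong (unreached u w *_) (regular w)) ⟩
      ∑ (λ w → unreached u w * d)                 ≡⟨ sym (*-distribʳ-sum d (unreached u)) ⟩
      ∑ (unreached u) * d                         ≡⟨ cong (_* d) (unreached-count u) ⟩
      ε * d                                       ∎
      where open ≡-Reasoning

    -- Double counting: each of the d out-neighbours of u misses ε vertices.
    ∑-missedOut : ∑ missedOut ≡ ε * d
    ∑-missedOut = begin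
      ∑ (λ v → ∑ (λ w → arc u w * unreached w v)) ≡⟨ ∑-comm (λ v w → arc u w * unreached w v) ⟩
      ∑ (λ w → ∑ (λ v → arc u w * unreached w v)) ≡⟨ sum-cong-≗ (λ w → sym (*-distribˡ-sum (arc u w) (unreached w))) ⟩
      ∑ (λ w → arc u w * ∑ (unreached w))         ≡⟨ sum-cong-≗ (λ w → cong (arc u w *_) (unreached-count w)) ⟩
      ∑ (λ w → arc u w * ε)                       ≡⟨ sym (*-distribʳ-sum ε (arc u)) ⟩
      ∑ (arc u) * ε                               ≡⟨ cong (_* ε) (regular u) ⟩
      d * ε                                       ≡⟨ *-comm d ε ⟩
      ε * d                                       ∎
      where open ≡-Reasoning

    -- A vertex of in-degree > d has an in-neighbour not reached from u.
    excess≤∑missedIn : excess G d ≤ ∑ missedIn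
    excess≤∑missedIn = count-≤-∑ (λ v → d <? indeg G v) missedIn positive
      where
      positive : ∀ v → d < indeg G v → 0 < missedIn v
      positive v d<indeg = +-cancelˡ-< d 0 (missedIn v) (begin-strict
        d + 0                     ≡⟨ +-identityʳ d ⟩
        d                         <⟨ d<indeg ⟩
        indeg G v                 ≤⟨ m≤m+n (indeg G v) (missedOut v) ⟩
        indeg G v + missedOut v   ≡⟨ balance v ⟩
        d + missedIn v            ∎)
        where open ≤-Reasoning

    -- A vertex of in-degree < d is missed by some out-neighbour of u.
    deficient≤∑missedOut : deficient G d ≤ ∑ missedOut
    deficient≤∑missedOut = count-≤-∑ (λ v → indeg G v <? d) missedOut positive
      where
      positive : ∀ v → indeg G v < d → 0 < missedOut v
      positive v indeg<d = +-cancelˡ-< (indeg G v) 0 (missedOut v) (begin-strict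
        indeg G v + 0             ≡⟨ +-identityʳ (indeg G v) ⟩
        indeg G v                 <⟨ indeg<d ⟩
        d                         ≤⟨ m≤m+n d (missedIn v) ⟩
        d + missedIn v            ≡⟨ sym (balance v) ⟩
        indeg G v + missedOut v   ∎)
        where open ≤-Reasoning

-- M(d,k) ≥ 1, so a digraph of order M(d,k) + ε has a vertex to base the count on.
M-positive : ∀ d k → 0 < M d k
M-positive d zero    = ≤-refl
M-positive d (suc k) = ≤-trans (M-positive d k) (m≤m+n (M d k) _)

corollary1 : (d k ε : ℕ) (G : Digraph (M d k + ε))
    → Geodetic G k
    → OutRegular G d
    → ¬ Diregular G d
    → deficient G d ≤ ε * d × excess G d ≤ ε * d
corollary1 d k ε G geodetic regular _ =
    ≤-trans (deficient≤∑missedOut u) (≤-reflexive (∑-missedOut u))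
  , ≤-trans (excess≤∑missedIn u) (≤-reflexive (∑-missedIn u))
  where
  open Excess d k ε G geodetic regular
  u : Fin (M d k + ε)
  u = F.fromℕ< (≤-trans (M-positive d k) (m≤m+n (M d k) ε))
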